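{- Let $D$ be a connected Eulerian digraph that has a unique partition $\mathcal{A}=\{\beta_1,\dots,\beta_t\}$ into cycles. Then $|V(\beta_i)\cap V(\beta_j)|\le 1$ for all $1\le i<j\le t$.
   Context: A digraph is a triple $D=(V(D),E(D),\psi)$ with finite sets and $\psi:E(D)\to V(D)\times V(D)$ having distinct coordinates (no loops; parallel edges allowed). Walks follow edge directions; a circuit is a closed trail up to cyclic rotation; a cycle is a circuit with no repeated vertices (length $\ge2$); $\mathcal{B}(D)$ is the set of cycles. $D$ is Eulerian if it has a closed trail traversing every edge. A partition of $D$ into cycles is a set $\mathcal{A}\subseteq\mathcal{B}(D)$ whose edge sets partition $E(D)$. -}

module Defs where

open import Data.Nat using (ℕ; _≤_)
open import Data.Fin using (Fin; _≟_)
open import Data.Product using (_×_; proj₁; proj₂; ∃; ∃-syntax; Σ-syntax)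
open import Data.List using (List; []; _∷_; _++_; take; drop; length; map; concat; filter; allFin)
open import Data.List.Relation.Unary.Linked using (Linked)
open import Data.List.Relation.Unary.All using (All)
open import Data.List.Relation.Unary.Unique.Propositional using (Unique)
open import Data.List.Membership.Propositional using (_∈_)
open import Data.List.Relation.Binary.Permutation.Propositional using (_↭_)
open import Relation.Binary.PropositionalEquality using (_≡_; _≢_)
import Data.List.Membership.DecPropositional as DecMem

-- A digraph: vertices Fin nV, edges Fin nE, ψ gives (tail , head);
-- no loops, parallel edges allowed.
record Digraph : Set where
  field
    nV  : ℕ
    nE  : ℕ
    ψ   : Fin nE → Fin nV × Fin nV
    noLoop : ∀ e → proj₁ (ψ e) ≢ proj₂ (ψ e)

module _ (D : Digraph) where
  open Digraph D

  Vertex : Set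
  Vertex = Fin nV

  Edge : Set
  Edge = Fin nE

  tl : Edge → Vertex
  tl e = proj₁ (ψ e)

  hd : Edge → Vertex
  hd e = proj₂ (ψ e)

  Consecutive : Edge → Edge → Set
  Consecutive e f = hd e ≡ tl f

  -- A closed walk given by its cyclic edge sequence e₁ … e_k
  -- (hd eᵢ = tl eᵢ₊₁ and hd e_k = tl e₁).
  ClosedWalk : List Edge → Set
  ClosedWalk es = Linked Consecutive (es ++ take 1 es)

  ClosedTrail : List Edge → Set
  ClosedTrail es = ClosedWalk es × Unique es

  verts : List Edge → List Vertex
  verts es = map tl es

  IsCycle : List Edge → Set
  IsCycle es = 2 ≤ length es × ClosedTrail es × Unique (verts es)

  SameCycle : List Edge → List Edge → Set
  SameCycle c d = ∃[ k ] (d ≡ drop k c ++ take k c)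

  Eulerian : Set
  Eulerian = ∃[ es ] (ClosedTrail es × (∀ e → e ∈ es))

  data Joined : Vertex → Vertex → Set where
    here  : ∀ {u} → Joined u u
    fwd   : ∀ {v} (e : Edge) → Joined (hd e) v → Joined (tl e) v
    bwd   : ∀ {v} (e : Edge) → Joined (tl e) v → Joined (hd e) v

  Connected : Set
  Connected = ∀ u v → Joined u v

  -- A partition of D into cycles: a collection of cycles whose edge
  -- sets partition E(D) (every edge occurs exactly once overall).
  IsPartition : List (List Edge) → Set
  IsPartition P = All IsCycle P × (concat P ↭ allFin nE)

  UniquePartition : List (List Edge) → Set
  UniquePartition A =
    IsPartition A ×
    (∀ Q → IsPartition Q →
      (∀ {c} → c ∈ A → ∃[ d ] (d ∈ Q × SameCycle c d)) ×
      (∀ {d} → d ∈ Q → ∃[ c ] (c ∈ A × SameCycle c d)))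

  commonVertices : List Edge → List Edge → ℕ
  commonVertices β γ = length (filter (λ v → v ∈? verts γ) (verts β))
    where open DecMem {A = Vertex} _≟_ using (_∈?_)

{-# OPTIONS --safe #-}
-- Suppose two cycles β, γ of the partition share vertices u ≠ v. Each splits
-- into a u→v path and a v→u path, β = P P′ and γ = Q Q′. The closed walks P Q′
-- and Q P′ decompose into cycles, which together with the other cycles of 𝒜
-- form a second partition of D into cycles. By uniqueness, the cycle of that
-- partition through an edge of P is a rotation of β, so it also contains the
-- edges of P′; but these lie in the other closed walk Q P′.
module Submission where

open import Defs
open import Data.Nat using (_≤_; _≤?_; s≤s; z≤n)
open import Data.Nat.Properties using (≰⇒>)
open import Data.Fin using (Fin; zero; suc; _<_; _≟_)
open import Data.List using (List; []; _∷_; [_]; _++_; length; lookup; filter; concat; take; drop)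
open import Data.List.Properties using (++-assoc; ++-identityʳ; map-++; concat-++; take++drop≡id)
open import Data.List.Relation.Unary.All as All using (All; []; _∷_)
open import Data.List.Relation.Unary.All.Properties using (¬Any⇒All¬; ++⁺; ++⁻ˡ; ++⁻ʳ)
open import Data.List.Relation.Unary.Any using (here; there)
open import Data.List.Relation.Unary.Linked using (Linked; []; [-]; _∷_)
open import Data.List.Relation.Unary.Unique.Propositional using (Unique; []; _∷_)
open import Data.List.Relation.Unary.Unique.Propositional.Properties as Unique using (Unique[x∷xs]⇒x∉xs)
open import Data.List.Relation.Binary.Disjoint.Propositional using (Disjoint)
open import Data.List.Relation.Binary.Subset.Propositional using (_⊆_)
open import Data.List.Membership.Propositional using (_∈_)
open import Data.List.Membership.Propositional.Properties using (∈-++⁺ˡ; ∈-++⁺ʳ; ∈-concat⁺′; ∈-concat⁻′; ∈-filter⁻; ∈-lookup)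
open import Data.List.Relation.Binary.Permutation.Propositional
  using (_↭_; refl; prep; swap; trans; ↭-sym; ↭-trans; ↭-reflexive; ↭⇒↭ₛ; module PermutationReasoning)
open import Data.List.Relation.Binary.Permutation.Propositional.Properties
  using (∈-resp-↭; All-resp-↭; map⁺; ++⁺ˡ; ++⁺ʳ; ++-comm; shift; shifts)
import Data.List.Relation.Binary.Permutation.Setoid.Properties as Permutationₛ
import Data.List.Membership.DecPropositional as DecMembership
open import Data.Product using (∃; ∃₂; _×_; _,_; proj₁; proj₂)
open import Data.Empty using (⊥; ⊥-elim)
open import Function using (_∘_)
open import Relation.Nullary using (yes; no)
open import Relation.Unary using (Decidable)
open import Relation.Binary.Definitions using (_Respects_)
open import Relation.Binary.PropositionalEquality using (_≡_; _≢_; refl; sym; subst; cong; setoid)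
import Relation.Binary.PropositionalEquality as ≡

module _ {A : Set} where

  Unique-resp-↭ : Unique {A = A} Respects _↭_
  Unique-resp-↭ p = Permutationₛ.Unique-resp-↭ (setoid A) (↭⇒↭ₛ p)

  Unique-++⁻ : ∀ (xs : List A) {ys} → Unique (xs ++ ys) → Unique xs × Unique ys × Disjoint xs ys
  Unique-++⁻ []       u         = [] , u , λ ()
  Unique-++⁻ (x ∷ xs) (x∉ ∷ u) with Unique-++⁻ xs u
  ... | uxs , uys , disjoint = ++⁻ˡ xs x∉ ∷ uxs , uys , λ
    { (here refl , v∈ys) → All.lookup (++⁻ʳ xs x∉) v∈ys refl
    ; (there v∈xs , v∈ys) → disjoint (v∈xs , v∈ys) }

  Unique[concat]⇒blocks-disjoint : ∀ {xss : List (List A)} {xs ys v} → Unique (concat xss) →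
    xs ∈ xss → ys ∈ xss → v ∈ xs → v ∈ ys → xs ≡ ys
  Unique[concat]⇒blocks-disjoint {xs′ ∷ xss} xss! (here refl) (here refl) _ _ = refl
  Unique[concat]⇒blocks-disjoint {xs′ ∷ xss} xss! (here refl) (there ys∈) v∈xs v∈ys =
    ⊥-elim (proj₂ (proj₂ (Unique-++⁻ xs′ xss!)) (v∈xs , ∈-concat⁺′ v∈ys ys∈))
  Unique[concat]⇒blocks-disjoint {xs′ ∷ xss} xss! (there xs∈) (here refl) v∈xs v∈ys =
    ⊥-elim (proj₂ (proj₂ (Unique-++⁻ xs′ xss!)) (v∈ys , ∈-concat⁺′ v∈xs xs∈))
  Unique[concat]⇒blocks-disjoint {xs′ ∷ xss} xss! (there xs∈) (there ys∈) v∈xs v∈ys =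
    Unique[concat]⇒blocks-disjoint (proj₁ (proj₂ (Unique-++⁻ xs′ xss!))) xs∈ ys∈ v∈xs v∈ys

  Unique-2≤length⇒distinct : ∀ {xs : List A} → Unique xs → 2 ≤ length xs →
    ∃₂ λ u v → u ≢ v × u ∈ xs × v ∈ xs
  Unique-2≤length⇒distinct {u ∷ v ∷ _} ((u≢v ∷ _) ∷ _) _ = u , v , u≢v , here refl , there (here refl)
  Unique-2≤length⇒distinct {_ ∷ []} _ (s≤s ())

  Unique-2≤length-filter⇒distinct : ∀ {P : A → Set} (P? : Decidable P) {xs} → Unique xs →
    2 ≤ length (filter P? xs) → ∃₂ λ u v → u ≢ v × (u ∈ xs × P u) × (v ∈ xs × P v)
  Unique-2≤length-filter⇒distinct P? xs! 2≤ with Unique-2≤length⇒distinct (Unique.filter⁺ P? xs!) 2≤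
  ... | u , v , u≢v , u∈ , v∈ = u , v , u≢v , ∈-filter⁻ P? u∈ , ∈-filter⁻ P? v∈

  concat-↭ : ∀ {xss yss : List (List A)} → xss ↭ yss → concat xss ↭ concat yss
  concat-↭ refl             = refl
  concat-↭ (prep xs p)      = ++⁺ˡ xs (concat-↭ p)
  concat-↭ (swap xs ys p)   = ↭-trans (shifts xs ys) (++⁺ˡ ys (++⁺ˡ xs (concat-↭ p)))
  concat-↭ (trans p q)      = ↭-trans (concat-↭ p) (concat-↭ q)

  ++-interchange-↭ : ∀ (a b c d : List A) → (a ++ b) ++ (c ++ d) ↭ (a ++ d) ++ (c ++ b)
  ++-interchange-↭ a b c d = begin
    (a ++ b) ++ (c ++ d)   ≡⟨ ++-assoc a b (c ++ d) ⟩
    a ++ b ++ c ++ d       ↭⟨ ++⁺ˡ a (++-comm b (c ++ d)) ⟩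
    a ++ (c ++ d) ++ b     ≡⟨ cong (a ++_) (++-assoc c d b) ⟩
    a ++ c ++ d ++ b       ↭⟨ ++⁺ˡ a (shifts c d) ⟩
    a ++ d ++ c ++ b       ≡⟨ ++-assoc a d (c ++ b) ⟨
    (a ++ d) ++ (c ++ b)   ∎
    where open PermutationReasoning

  rotate-↭ : ∀ k (xs : List A) → drop k xs ++ take k xs ↭ xs
  rotate-↭ k xs = ↭-trans (++-comm (drop k xs) (take k xs)) (↭-reflexive (take++drop≡id k xs))

  lookup-↭ : ∀ (xs : List A) i → ∃ λ ys → xs ↭ lookup xs i ∷ ys
  lookup-↭ (x ∷ xs) zero    = xs , refl
  lookup-↭ (x ∷ xs) (suc i) with lookup-↭ xs i
  ... | ys , xs↭ = x ∷ ys , ↭-trans (prep x xs↭) (swap x (lookup xs i) refl)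

  lookup-pair-↭ : ∀ (xs : List A) {i j} → i < j → ∃ λ ys → xs ↭ lookup xs i ∷ lookup xs j ∷ ys
  lookup-pair-↭ (x ∷ xs) {zero} {suc j} _ with lookup-↭ xs j
  ... | ys , xs↭ = ys , prep x xs↭
  lookup-pair-↭ (x ∷ xs) {suc i} {suc j} (s≤s i<j) with lookup-pair-↭ xs i<j
  ... | ys , xs↭ = x ∷ ys , ↭-trans (prep x xs↭) (shifts [ x ] (lookup xs i ∷ lookup xs j ∷ []))

module _ (D : Digraph) where
  open Digraph D using (noLoop)
  open DecMembership {A = Vertex D} _≟_ using (_∈?_)

  private
    variable
      x y z u v w : Vertex D
      e f : Edge D
      es fs : List (Edge D)

  data Path : Vertex D → Vertex D → List (Edge D) → Set where
    nil  : x ≡ y → Path x y []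
    cons : tl D e ≡ x → Path (hd D e) y es → Path x y (e ∷ es)

  Path-++ : Path x y es → Path y z fs → Path x z (es ++ fs)
  Path-++ (nil refl) q = q
  Path-++ (cons t p) q = cons t (Path-++ p q)

  Path-nonempty : x ≢ y → Path x y es → ∃ λ e → e ∈ es
  Path-nonempty x≢y (nil x≡y)          = ⊥-elim (x≢y x≡y)
  Path-nonempty _   (cons {e = e} _ _) = e , here refl

  Path⇒start∈ : Path x y es → x ∈ verts D es ++ [ y ]
  Path⇒start∈ (nil refl)    = here refl
  Path⇒start∈ (cons refl _) = here refl

  Path-split : Path x y es → w ∈ verts D es ++ [ y ] →
    ∃₂ λ as bs → es ≡ as ++ bs × Path x w as × Path w y bs
  Path-split (nil x≡y) (here refl) = [] , [] , refl , nil x≡y , nil refl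
  Path-split (cons {e = e} {es = es} t p) (here refl) = [] , e ∷ es , refl , nil (sym t) , cons refl p
  Path-split (cons {e = e} t p) (there w∈) with Path-split p w∈
  ... | as , bs , refl , pas , pbs = e ∷ as , bs , refl , cons t pas , pbs

  Path-rotate : Path x x es → u ∈ verts D es → ∃ λ es′ → es′ ↭ es × Path u u es′
  Path-rotate p u∈ with Path-split p (∈-++⁺ˡ u∈)
  ... | as , bs , refl , pas , pbs = bs ++ as , ++-comm bs as , Path-++ pbs pas

  Path⇒Linked : Path x y es → y ≡ tl D f → Linked (Consecutive D) (es ++ [ f ])
  Path⇒Linked (nil _)               _   = [-]
  Path⇒Linked (cons _ (nil h≡y))    y≡f = ≡.trans h≡y y≡f ∷ [-]
  Path⇒Linked (cons _ p@(cons t _)) y≡f = sym t ∷ Path⇒Linked p y≡f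

  Linked⇒Path : ∀ e es f → Linked (Consecutive D) (e ∷ es ++ [ f ]) → Path (tl D e) (tl D f) (e ∷ es)
  Linked⇒Path e []        f (c ∷ [-]) = cons refl (nil c)
  Linked⇒Path e (e′ ∷ es) f (c ∷ l) with Linked⇒Path e′ es f l
  ... | cons _ p = cons refl (cons (sym c) p)

  ClosedWalk-split : ∀ {β} → ClosedWalk D β → u ∈ verts D β → v ∈ verts D β →
    ∃₂ λ p q → β ↭ p ++ q × Path u v p × Path v u q
  ClosedWalk-split {β = e ∷ es} closed u∈ v∈ with Path-rotate (Linked⇒Path e es e closed) u∈
  ... | es′ , es′↭ , circuit with Path-split circuit (∈-++⁺ˡ (∈-resp-↭ (map⁺ (tl D) (↭-sym es′↭)) v∈))
  ... | p , q , refl , puv , pvu = p , q , ↭-sym es′↭ , puv , pvu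

  simpleClosedPath⇒IsCycle : Path x x (e ∷ es) → Unique (verts D (e ∷ es)) → IsCycle D (e ∷ es)
  simpleClosedPath⇒IsCycle (cons t (nil h≡x)) _ = ⊥-elim (noLoop _ (≡.trans t (sym h≡x)))
  simpleClosedPath⇒IsCycle {es = _ ∷ _} p@(cons t _) u =
    s≤s (s≤s z≤n) , (Path⇒Linked p (sym t) , Unique.map⁻ u) , u

  record CyclesAndSimplePath (x y : Vertex D) (es : List (Edge D)) : Set where
    field
      cycles        : List (List (Edge D))
      rest          : List (Edge D)
      cycles-valid  : All (IsCycle D) cycles
      rest-path     : Path x y rest
      rest-simple   : Unique (verts D rest ++ [ y ])
      edges-↭       : concat cycles ++ rest ↭ es

  -- If x = tl e already lies on the simple rest, the part of the rest up to x
  -- closes a cycle with e; otherwise e just extends the rest.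
  cons-CyclesAndSimplePath : tl D e ≡ x → CyclesAndSimplePath (hd D e) y es → CyclesAndSimplePath x y (e ∷ es)
  cons-CyclesAndSimplePath {e} {y = y} refl
    record { cycles = Cs ; rest = rest ; cycles-valid = valid ; rest-path = p ; rest-simple = simple ; edges-↭ = Cs↭ }
    with tl D e ∈? verts D rest ++ [ y ]
  ... | no x∉ = record
    { cycles       = Cs
    ; rest         = e ∷ rest
    ; cycles-valid = valid
    ; rest-path    = cons refl p
    ; rest-simple  = ¬Any⇒All¬ _ x∉ ∷ simple
    ; edges-↭      = ↭-trans (shift e (concat Cs) rest) (prep e Cs↭)
    }
  ... | yes x∈ with Path-split p x∈
  ...   | as , bs , refl , pas , pbs = record
    { cycles       = (e ∷ as) ∷ Cs
    ; rest         = bs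
    ; cycles-valid = simpleClosedPath⇒IsCycle (cons refl pas) (x∉as ∷ simple-as) ∷ valid
    ; rest-path    = pbs
    ; rest-simple  = simple-bs
    ; edges-↭      = prep e (begin
        (as ++ concat Cs) ++ bs   ≡⟨ ++-assoc as (concat Cs) bs ⟩
        as ++ concat Cs ++ bs     ↭⟨ shifts as (concat Cs) ⟩
        concat Cs ++ as ++ bs     ↭⟨ Cs↭ ⟩
        _                         ∎)
    }
    where
    open PermutationReasoning
    verts-split : verts D (as ++ bs) ++ [ y ] ≡ verts D as ++ verts D bs ++ [ y ]
    verts-split = ≡.trans (cong (_++ [ y ]) (map-++ (tl D) as bs)) (++-assoc (verts D as) (verts D bs) [ y ])
    parts : Unique (verts D as) × Unique (verts D bs ++ [ y ]) × Disjoint (verts D as) (verts D bs ++ [ y ])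
    parts = Unique-++⁻ (verts D as) (subst Unique verts-split simple)
    simple-as : Unique (verts D as)
    simple-as = proj₁ parts
    simple-bs : Unique (verts D bs ++ [ y ])
    simple-bs = proj₁ (proj₂ parts)
    x∉as : All (tl D e ≢_) (verts D as)
    x∉as = ¬Any⇒All¬ _ (λ x∈as → proj₂ (proj₂ parts) (x∈as , Path⇒start∈ pbs))

  Path⇒CyclesAndSimplePath : Path x y es → CyclesAndSimplePath x y es
  Path⇒CyclesAndSimplePath (nil refl) = record
    { cycles = [] ; rest = [] ; cycles-valid = [] ; rest-path = nil refl ; rest-simple = [] ∷ [] ; edges-↭ = refl }
  Path⇒CyclesAndSimplePath (cons t p) = cons-CyclesAndSimplePath t (Path⇒CyclesAndSimplePath p)

  closedPath⇒cycles : Path x x es → ∃ λ Cs → All (IsCycle D) Cs × concat Cs ↭ es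
  closedPath⇒cycles p with Path⇒CyclesAndSimplePath p
  ... | record { cycles = Cs ; rest = [] ; cycles-valid = valid ; edges-↭ = Cs↭ } =
    Cs , valid , ↭-trans (↭-reflexive (sym (++-identityʳ (concat Cs)))) Cs↭
  ... | record { rest = g ∷ bs ; rest-path = cons refl _ ; rest-simple = simple } =
    ⊥-elim (Unique[x∷xs]⇒x∉xs simple (∈-++⁺ʳ (verts D bs) (here refl)))

  IsPartition⇒Unique : ∀ {P} → IsPartition D P → Unique (concat P)
  IsPartition⇒Unique (_ , P↭) = Unique-resp-↭ (↭-sym P↭) (Unique.allFin⁺ _)

  IsPartition-replace : ∀ {A Bs Cs R} → IsPartition D A → A ↭ Bs ++ R →
    All (IsCycle D) Cs → concat Cs ↭ concat Bs → IsPartition D (Cs ++ R)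
  IsPartition-replace {A} {Bs} {Cs} {R} (validA , A↭E) A↭ validCs Cs↭Bs =
    ++⁺ validCs (++⁻ʳ Bs (All-resp-↭ A↭ validA)) , (begin
      concat (Cs ++ R)        ≡⟨ concat-++ Cs R ⟨
      concat Cs ++ concat R   ↭⟨ ++⁺ʳ (concat R) Cs↭Bs ⟩
      concat Bs ++ concat R   ≡⟨ concat-++ Bs R ⟩
      concat (Bs ++ R)        ↭⟨ concat-↭ (↭-sym A↭) ⟩
      concat A                ↭⟨ A↭E ⟩
      _                       ∎)
    where open PermutationReasoning

  UniquePartition⇒block⊆ : ∀ {A Q β d} → UniquePartition D A → IsPartition D Q →
    β ∈ A → d ∈ Q → e ∈ β → e ∈ d → β ⊆ d
  UniquePartition⇒block⊆ {β = β} (partA , unique) partQ β∈A d∈Q e∈β e∈d with proj₂ (unique _ partQ) d∈Q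
  ... | c , c∈A , k , refl = ∈-resp-↭ (↭-sym (rotate-↭ k c)) ∘ subst (_ ∈_) (sym c≡β)
    where
    c≡β : c ≡ β
    c≡β = Unique[concat]⇒blocks-disjoint (IsPartition⇒Unique partA) c∈A β∈A (∈-resp-↭ (rotate-↭ k c) e∈d) e∈β

  UniquePartition⇒¬exchangeable : ∀ {A β γ R p p′ q q′} → UniquePartition D A → A ↭ β ∷ γ ∷ R →
    β ↭ p ++ p′ → γ ↭ q ++ q′ → u ≢ v →
    Path u v p → Path v u p′ → Path u v q → Path v u q′ → ⊥
  UniquePartition⇒¬exchangeable {β = β} {γ} {R} {p} {p′} {q} {q′} uniqueA@(partA , _) A↭ β↭ γ↭ u≢v
    puv p′vu quv q′vu
    with closedPath⇒cycles (Path-++ puv q′vu) | closedPath⇒cycles (Path-++ quv p′vu)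
       | Path-nonempty u≢v puv | Path-nonempty (u≢v ∘ sym) p′vu
  ... | C₁ , valid₁ , C₁↭ | C₂ , valid₂ , C₂↭ | e , e∈p | f , f∈p′ =
    proj₂ (proj₂ (Unique-++⁻ (p ++ q′) walks-Unique)) (f∈pq′ , ∈-++⁺ʳ q f∈p′)
    where
    open PermutationReasoning
    walks↭ : (p ++ q′) ++ (q ++ p′) ↭ β ++ γ
    walks↭ = begin
      (p ++ q′) ++ (q ++ p′)   ↭⟨ ++-interchange-↭ p q′ q p′ ⟩
      (p ++ p′) ++ (q ++ q′)   ↭⟨ ++⁺ʳ (q ++ q′) (↭-sym β↭) ⟩
      β ++ (q ++ q′)           ↭⟨ ++⁺ˡ β (↭-sym γ↭) ⟩
      β ++ γ                   ∎

    walks-Unique : Unique ((p ++ q′) ++ (q ++ p′))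
    walks-Unique = Unique-resp-↭ (↭-sym walks↭) (proj₁ (Unique-++⁻ (β ++ γ) βγR-Unique))
      where
      βγR-Unique : Unique ((β ++ γ) ++ concat R)
      βγR-Unique = subst Unique (sym (++-assoc β γ (concat R)))
        (Unique-resp-↭ (concat-↭ A↭) (IsPartition⇒Unique partA))

    exchange : concat (C₁ ++ C₂) ↭ concat (β ∷ γ ∷ [])
    exchange = begin
      concat (C₁ ++ C₂)        ≡⟨ concat-++ C₁ C₂ ⟨
      concat C₁ ++ concat C₂   ↭⟨ ↭-trans (++⁺ʳ (concat C₂) C₁↭) (++⁺ˡ (p ++ q′) C₂↭) ⟩
      (p ++ q′) ++ (q ++ p′)   ↭⟨ walks↭ ⟩
      β ++ γ                   ≡⟨ cong (β ++_) (++-identityʳ γ) ⟨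
      β ++ γ ++ []             ∎

    partQ : IsPartition D ((C₁ ++ C₂) ++ R)
    partQ = IsPartition-replace partA A↭ (++⁺ valid₁ valid₂) exchange

    β⊆ : ∀ {d} → d ∈ C₁ → e ∈ d → β ⊆ d
    β⊆ d∈C₁ = UniquePartition⇒block⊆ uniqueA partQ (∈-resp-↭ (↭-sym A↭) (here refl))
      (∈-++⁺ˡ (∈-++⁺ˡ d∈C₁)) (∈-resp-↭ (↭-sym β↭) (∈-++⁺ˡ e∈p))

    f∈pq′ : f ∈ p ++ q′
    f∈pq′ with ∈-concat⁻′ C₁ (∈-resp-↭ (↭-sym C₁↭) (∈-++⁺ˡ e∈p))
    ... | d , e∈d , d∈C₁ =
      ∈-resp-↭ C₁↭ (∈-concat⁺′ (β⊆ d∈C₁ e∈d (∈-resp-↭ (↭-sym β↭) (∈-++⁺ʳ p f∈p′))) d∈C₁)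

  UniquePartition⇒¬twoCommonVertices : ∀ {A β γ R} → UniquePartition D A → A ↭ β ∷ γ ∷ R → u ≢ v →
    u ∈ verts D β → v ∈ verts D β → u ∈ verts D γ → v ∈ verts D γ → ⊥
  UniquePartition⇒¬twoCommonVertices uniqueA@((validA , _) , _) A↭ u≢v uβ vβ uγ vγ
    with All-resp-↭ A↭ validA
  ... | (_ , (β-closed , _) , _) ∷ (_ , (γ-closed , _) , _) ∷ _
    with ClosedWalk-split β-closed uβ vβ | ClosedWalk-split γ-closed uγ vγ
  ... | p , p′ , β↭ , puv , p′vu | q , q′ , γ↭ , quv , q′vu =
    UniquePartition⇒¬exchangeable uniqueA A↭ β↭ γ↭ u≢v puv p′vu quv q′vu

mainTheorem6 : (D : Digraph) → Connected D → Eulerian D →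
    (A : List (List (Edge D))) → UniquePartition D A →
    (i j : Fin (length A)) → i < j →
    commonVertices D (lookup A i) (lookup A j) ≤ 1
mainTheorem6 D _ _ A uniqueA@((validA , _) , _) i j i<j with commonVertices D (lookup A i) (lookup A j) ≤? 1
... | yes ≤1 = ≤1
... | no ≰1
  with Unique-2≤length-filter⇒distinct _ (proj₂ (proj₂ (All.lookup validA (∈-lookup i)))) (≰⇒> ≰1)
... | u , v , u≢v , (uβ , uγ) , (vβ , vγ) =
  ⊥-elim (UniquePartition⇒¬twoCommonVertices D uniqueA (proj₂ (lookup-pair-↭ A i<j)) u≢v uβ vβ uγ vγ)
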